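{- Let $\mathbf{k}$ be a field in which $n!$ is invertible. Fix a $j$-element subset $U\subseteq[n]=\{1,\ldots,n\}$ and a permutation $\mathbf{a}=(a_1,\ldots,a_{n-j})$ of $[n]\setminus U$ (written as a word). Then, in $\mathbf{k}\mathscr{F}_n$, $$x\cdot\Psi_U(\mathbf{a})=j\cdot\Psi_U(\mathbf{a})+\Phi_U\big(x_{[n]\setminus U}\cdot\mathbf{a}\big).$$ Consequently, if $v\in\mathbf{k}\mathscr{F}_{[n]\setminus U,\,n-j}$ satisfies $x_{[n]\setminus U}\cdot v=0$, then $x\cdot\Psi_U(v)=j\cdot\Psi_U(v)$.
   Context: For a finite set $S$, $\mathscr{F}_S$ is the free left-regular band on $S$: the monoid of words in letters from $S$ with no repeated letters, with product $(a_1,\ldots,a_\ell)\cdot(b_1,\ldots,b_m)=(a_1,\ldots,a_\ell,b_1,\ldots,b_m)^\wedge$, where $^\wedge$ deletes every entry already occurring earlier in the sequence; $\mathscr{F}_n=\mathscr{F}_{[n]}$. $\mathscr{F}_{S,|S|}$ denotes the words of length $|S|$ (permutations of $S$), and $\mathbf{k}\mathscr{F}_{S,|S|}$ their span, a left ideal of the monoid algebra $\mathbf{k}\mathscr{F}_S$. $x_S=\sum_{i\in S}(i)\in\mathbf{k}\mathscr{F}_S$ and $x=x_{[n]}$. Let $\mathfrak{S}_U$ be the set of permutations $\mathbf{b}=(b_1,\ldots,b_j)$ of $U$. Define $\mathbf{k}$-linear maps $\Psi_U,\Phi_U:\mathbf{k}\mathscr{F}_{[n]\setminus U,n-j}\to\mathbf{k}\mathscr{F}_{n}$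 on basis words by $\Psi_U(\mathbf{a})=\sum_{\mathbf{b}\in\mathfrak{S}_U}(b_1,\ldots,b_j,a_1,\ldots,a_{n-j})$ and $\Phi_U(\mathbf{a})=\sum_{\mathbf{b}\in\mathfrak{S}_U}(a_1,b_1,\ldots,b_j,a_2,\ldots,a_{n-j})$. -}

module Defs where

open import Level using (_⊔_)
open import Data.Nat using (ℕ; zero; suc)
open import Data.Fin using (Fin; _≟_)
open import Data.Fin.Subset using (Subset; _∈_; _∉_; ∣_∣)
open import Data.Fin.Subset.Properties using (_∈?_)
open import Data.List using (List; []; _∷_; _++_; map; concatMap; foldr; filter; deduplicate; allFin)
open import Data.List.Properties using (≡-dec)
open import Data.List.Relation.Unary.Unique.Propositional using (Unique)
open import Data.List.Relation.Unary.All using (All)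
import Data.List.Membership.Propositional as Mem
open import Data.Product using (_×_; _,_; Σ)
open import Function.Bundles using (_⇔_)
open import Relation.Nullary using (¬_; yes; no; ¬?)
open import Relation.Binary.PropositionalEquality using (_≡_)
open import Algebra.Bundles using (CommutativeRing)

record IsField {c ℓ} (R : CommutativeRing c ℓ) : Set (c ⊔ ℓ) where
  open CommutativeRing R
  field
    0≉1     : ¬ (0# ≈ 1#)
    inverse : ∀ x → ¬ (x ≈ 0#) → Σ Carrier (λ y → x * y ≈ 1#)

insertions : ∀ {a} {A : Set a} → A → List A → List (List A)
insertions x [] = (x ∷ []) ∷ []
insertions x (y ∷ ys) = (x ∷ y ∷ ys) ∷ map (y ∷_) (insertions x ys)

perms : ∀ {a} {A : Set a} → List A → List (List A)
perms [] = [] ∷ []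
perms (x ∷ xs) = concatMap (insertions x) (perms xs)

members : ∀ {n} → Subset n → List (Fin n)
members U = filter (_∈? U) (allFin _)

nonmembers : ∀ {n} → Subset n → List (Fin n)
nonmembers U = filter (λ i → ¬? (i ∈? U)) (allFin _)

-- Words over the alphabet Fin n (letters 0..n-1 stand for 1..n).
Word : ℕ → Set
Word n = List (Fin n)

-- Product in the free left-regular band: concatenate, then delete
-- every entry already occurring earlier.
_·w_ : ∀ {n} → Word n → Word n → Word n
u ·w w = deduplicate _≟_ (u ++ w)

IsPermOfCompl : ∀ {n} → Subset n → Word n → Set
IsPermOfCompl {n} U a = Unique a × (∀ (i : Fin n) → (i Mem.∈ a) ⇔ (i ∉ U))

-- The monoid algebra k𝓕_n over a commutative ring R, as formal linear combinations.
module FLRB {c ℓ} (R : CommutativeRing c ℓ) (n : ℕ) where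
  open CommutativeRing R renaming (Carrier to K)
  open import Algebra.Definitions.RawMonoid +-rawMonoid renaming (_×_ to _·ℕ_)

  ι : ℕ → K
  ι m = m ·ℕ 1#

  Elt : Set c
  Elt = List (K × Word n)

  coeff : Word n → Elt → K
  coeff w = foldr (λ { (c , u) s → if? u c s }) 0#
    where
    if? : Word n → K → K → K
    if? u c s with ≡-dec _≟_ u w
    ... | yes _ = c + s
    ... | no _  = s

  _≋_ : Elt → Elt → Set ℓ
  e ≋ f = ∀ (w : Word n) → coeff w e ≈ coeff w f

  zeroE : Elt
  zeroE = []

  _⊕_ : Elt → Elt → Elt
  e ⊕ f = e ++ f

  _⊙_ : ℕ → Elt → Elt
  m ⊙ e = map (λ { (c , u) → (ι m * c , u) }) e

  _⊛_ : Elt → Elt → Elt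
  e ⊛ f = concatMap (λ { (c , u) → map (λ { (d , w) → (c * d , u ·w w) }) f }) e

  [_] : Word n → Elt
  [ w ] = (1# , w) ∷ []

  -- x_S = Σ_{i∈S} (i), for S given as a list of distinct letters
  xOf : List (Fin n) → Elt
  xOf S = map (λ i → (1# , i ∷ [])) S

  x : Elt
  x = xOf (allFin n)

  Ψw : Subset n → Word n → Elt
  Ψw U a = map (λ b → (1# , b ++ a)) (perms (members U))

  -- Φ_U(a₁,…,a_{n-j}) = Σ_b (a₁,b₁,…,b_j,a₂,…); on the empty word (which only
  -- occurs when U = [n], and never in the statement) it is set to 0.
  Φw : Subset n → Word n → Elt
  Φw U [] = zeroE
  Φw U (a₁ ∷ as) = map (λ b → (1# , a₁ ∷ (b ++ as))) (perms (members U))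

  linExt : (Word n → Elt) → Elt → Elt
  linExt F e = concatMap (λ { (c , u) → map (λ { (d , w) → (c * d , w) }) (F u) }) e

  Ψ : Subset n → Elt → Elt
  Ψ U = linExt (Ψw U)

  Φ : Subset n → Elt → Elt
  Φ U = linExt (Φw U)

-- Every element of k𝓕_n is determined by the values eval g e = Σ c · g(w) of the linear functionals extending
-- maps g from words to k, and all operations involved are linear, so it suffices to compute on words. For a
-- letter i and a permutation b of U, the product (i) · (b a) deletes the later occurrence of i: if i ∉ U this
-- gives (i, b, a without i), the terms of Φ_U(x_{[n]∖U} · a); if i ∈ U it gives (i, b without i, a). Deleting
-- i from the permutations of U is j-to-one onto the permutations of U ∖ {i}, so summing over i ∈ U reaches
-- every permutation of U exactly j times, which is j · Ψ_U(a). The second claim follows by linearity, the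
-- Φ_U term vanishing because x_{[n]∖U} · v = 0.

module Submission where

open import Defs
open import Data.Nat using (ℕ)
open import Data.Nat using (_!)
open import Data.Fin.Subset using (Subset; ∣_∣)
open import Data.List.Relation.Unary.All using (All)
open import Data.Product using (_×_; _,_; Σ; proj₂)
open import Algebra.Bundles using (CommutativeRing)

open import Level using (Level; _⊔_)
open import Function using (_∘_; id)
open import Function.Bundles using (Equivalence)
open import Data.Empty using (⊥-elim)
open import Data.Nat using (zero; suc)
open import Data.Nat.Properties using (suc-injective)
import Data.Fin as Fin
open import Data.Fin.Subset using (inside; outside) renaming (_∈_ to _∈ₛ_; _∉_ to _∉ₛ_)
open import Data.Fin.Subset.Properties using (_∈?_)
open import Data.Vec using (_∷_; [])
open import Data.Product using (proj₁)
open import Data.List using (List; []; _∷_; _++_; map; concatMap; filter; length; deduplicate; allFin; tabulate)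
open import Data.List.Properties using (≡-dec; map-tabulate; filter-all; filter-accept; filter-reject; filter-++)
import Data.List.Relation.Unary.All as All
open import Data.List.Relation.Unary.All using (_∷_)
open import Data.List.Relation.Unary.Any using (here; there)
open import Data.List.Relation.Unary.AllPairs using ([]; _∷_)
open import Data.List.Relation.Unary.Unique.Propositional using (Unique)
open import Data.List.Relation.Unary.Unique.Propositional.Properties using (filter⁺; ++⁺; allFin⁺; Unique[x∷xs]⇒x∉xs)
open import Data.List.Relation.Unary.Unique.DecPropositional.Properties using (deduplicate-!)
open import Data.List.Membership.Propositional using (_∈_; _∉_; find)
open import Data.List.Membership.Propositional.Properties
  using (∈-filter⁻; ∈-filter⁺; ∈-map⁻; ∈-map⁺; ∈-concatMap⁻; ∈-++⁺ˡ; ∈-++⁺ʳ; ∈-deduplicate⁺)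
open import Data.List.Relation.Binary.Permutation.Propositional using (_↭_; ↭-refl; ↭-prep; ↭-swap; ↭-trans; ↭-sym; ↭⇒↭ₛ)
open import Data.List.Relation.Binary.Permutation.Propositional.Properties using (∈-resp-↭)
open import Relation.Nullary using (Dec; yes; no; ¬?)
open import Relation.Unary using (Pred; Decidable)
open import Relation.Binary.Definitions using (DecidableEquality)
import Relation.Binary.PropositionalEquality as ≡
open ≡ using (_≡_; _≢_)
open import Algebra.Bundles using (CommutativeMonoid)

module ListSum {c ℓ} (M : CommutativeMonoid c ℓ) where
  open CommutativeMonoid M
    renaming (Carrier to C; _∙_ to _+_; ∙-cong to +-cong; ∙-congˡ to +-congˡ; ∙-congʳ to +-congʳ)
  open import Algebra.Properties.CommutativeSemigroup commutativeSemigroup using (interchange; x∙yz≈y∙xz)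
  open import Algebra.Definitions.RawMonoid rawMonoid renaming (_×_ to _·ℕ_)
  open import Relation.Binary.Reasoning.Setoid setoid

  private variable
    a b : Level
    A B : Set a

  ∑ : (A → C) → List A → C
  ∑ f []      = ε
  ∑ f (x ∷ l) = f x + ∑ f l

  ∑-cong-∈ : ∀ {f g : A → C} l → (∀ {x} → x ∈ l → f x ≈ g x) → ∑ f l ≈ ∑ g l
  ∑-cong-∈ []      f≈g = refl
  ∑-cong-∈ (x ∷ l) f≈g = +-cong (f≈g (here ≡.refl)) (∑-cong-∈ l (f≈g ∘ there))

  ∑-cong : ∀ {f g : A → C} l → (∀ x → f x ≈ g x) → ∑ f l ≈ ∑ g l
  ∑-cong l f≈g = ∑-cong-∈ l (λ {x} _ → f≈g x)

  ∑-++ : ∀ (f : A → C) l l′ → ∑ f (l ++ l′) ≈ ∑ f l + ∑ f l′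
  ∑-++ f []      l′ = sym (identityˡ _)
  ∑-++ f (x ∷ l) l′ = trans (+-congˡ (∑-++ f l l′)) (sym (assoc _ _ _))

  ∑-map : ∀ (f : B → C) (h : A → B) l → ∑ f (map h l) ≈ ∑ (f ∘ h) l
  ∑-map f h []      = refl
  ∑-map f h (x ∷ l) = +-congˡ (∑-map f h l)

  ∑-concatMap : ∀ (f : B → C) (h : A → List B) l → ∑ f (concatMap h l) ≈ ∑ (∑ f ∘ h) l
  ∑-concatMap f h []      = refl
  ∑-concatMap f h (x ∷ l) = trans (∑-++ f (h x) (concatMap h l)) (+-congˡ (∑-concatMap f h l))

  ∑-distrib-+ : ∀ (f g : A → C) l → ∑ (λ x → f x + g x) l ≈ ∑ f l + ∑ g l
  ∑-distrib-+ f g []      = sym (identityˡ _)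
  ∑-distrib-+ f g (x ∷ l) = trans (+-congˡ (∑-distrib-+ f g l)) (interchange _ _ _ _)

  ∑-ε : ∀ (l : List A) → ∑ (λ _ → ε) l ≈ ε
  ∑-ε []      = refl
  ∑-ε (x ∷ l) = trans (identityˡ _) (∑-ε l)

  ∑-distrib-·ℕ : ∀ m (f : A → C) l → ∑ (λ x → m ·ℕ f x) l ≈ m ·ℕ ∑ f l
  ∑-distrib-·ℕ zero    f l = ∑-ε l
  ∑-distrib-·ℕ (suc m) f l = trans (∑-distrib-+ f _ l) (+-congˡ (∑-distrib-·ℕ m f l))

  ∑-comm : ∀ (h : A → B → C) l l′ → ∑ (λ x → ∑ (h x) l′) l ≈ ∑ (λ y → ∑ (λ x → h x y) l) l′
  ∑-comm h []      l′ = sym (∑-ε l′)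
  ∑-comm h (x ∷ l) l′ = trans (+-congˡ (∑-comm h l l′)) (sym (∑-distrib-+ (h x) _ l′))

  ∑-partition : ∀ {p} {P : Pred A p} (P? : Decidable P) (f : A → C) l →
                ∑ f l ≈ ∑ f (filter P? l) + ∑ f (filter (¬? ∘ P?) l)
  ∑-partition P? f []      = sym (identityˡ _)
  ∑-partition P? f (x ∷ l) with P? x
  ... | yes _ = trans (+-congˡ (∑-partition P? f l)) (sym (assoc _ _ _))
  ... | no  _ = trans (+-congˡ (∑-partition P? f l)) (x∙yz≈y∙xz _ _ _)

module Removal {a} {A : Set a} (_≟_ : DecidableEquality A) where

  -- The filter used by deduplicate, so that deduplicate (x ∷ l) unfolds to moveToFront x (deduplicate l).
  remove : A → List A → List A
  remove x = filter (¬? ∘ (x ≟_))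

  moveToFront : A → List A → List A
  moveToFront x l = x ∷ remove x l

  remove-≡ : ∀ {x y} l → x ≡ y → remove x (y ∷ l) ≡ remove x l
  remove-≡ {x} l x≡y = filter-reject (¬? ∘ (x ≟_)) (λ x≢y → x≢y x≡y)

  remove-≢ : ∀ {x y} l → x ≢ y → remove x (y ∷ l) ≡ y ∷ remove x l
  remove-≢ {x} l = filter-accept (¬? ∘ (x ≟_))

  remove-∉ : ∀ {x} l → x ∉ l → remove x l ≡ l
  remove-∉ {x} l x∉l = filter-all (¬? ∘ (x ≟_)) (All.tabulate λ y∈l x≡y → x∉l (≡.subst (_∈ l) (≡.sym x≡y) y∈l))

  remove-++ : ∀ x l l′ → remove x (l ++ l′) ≡ remove x l ++ remove x l′
  remove-++ x = filter-++ (¬? ∘ (x ≟_))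

  remove-comm : ∀ x y l → remove x (remove y l) ≡ remove y (remove x l)
  remove-comm x y []      = ≡.refl
  remove-comm x y (z ∷ l) = cases (x ≟ z) (y ≟ z)
    where
    open ≡.≡-Reasoning
    ih : remove x (remove y l) ≡ remove y (remove x l)
    ih = remove-comm x y l
    cases : Dec (x ≡ z) → Dec (y ≡ z) → remove x (remove y (z ∷ l)) ≡ remove y (remove x (z ∷ l))
    cases (yes x≡z) (yes y≡z) = begin
      remove x (remove y (z ∷ l)) ≡⟨ ≡.cong (remove x) (remove-≡ l y≡z) ⟩
      remove x (remove y l)       ≡⟨ ih ⟩
      remove y (remove x l)       ≡⟨ ≡.cong (remove y) (remove-≡ l x≡z) ⟨
      remove y (remove x (z ∷ l)) ∎
    cases (yes x≡z) (no y≢z) = begin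
      remove x (remove y (z ∷ l)) ≡⟨ ≡.cong (remove x) (remove-≢ l y≢z) ⟩
      remove x (z ∷ remove y l)   ≡⟨ remove-≡ (remove y l) x≡z ⟩
      remove x (remove y l)       ≡⟨ ih ⟩
      remove y (remove x l)       ≡⟨ ≡.cong (remove y) (remove-≡ l x≡z) ⟨
      remove y (remove x (z ∷ l)) ∎
    cases (no x≢z) (yes y≡z) = begin
      remove x (remove y (z ∷ l)) ≡⟨ ≡.cong (remove x) (remove-≡ l y≡z) ⟩
      remove x (remove y l)       ≡⟨ ih ⟩
      remove y (remove x l)       ≡⟨ remove-≡ (remove x l) y≡z ⟨
      remove y (z ∷ remove x l)   ≡⟨ ≡.cong (remove y) (remove-≢ l x≢z) ⟨
      remove y (remove x (z ∷ l)) ∎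
    cases (no x≢z) (no y≢z) = begin
      remove x (remove y (z ∷ l)) ≡⟨ ≡.cong (remove x) (remove-≢ l y≢z) ⟩
      remove x (z ∷ remove y l)   ≡⟨ remove-≢ (remove y l) x≢z ⟩
      z ∷ remove x (remove y l)   ≡⟨ ≡.cong (z ∷_) ih ⟩
      z ∷ remove y (remove x l)   ≡⟨ remove-≢ (remove x l) y≢z ⟨
      remove y (z ∷ remove x l)   ≡⟨ ≡.cong (remove y) (remove-≢ l x≢z) ⟨
      remove y (remove x (z ∷ l)) ∎

  ∉-remove : ∀ x l → x ∉ remove x l
  ∉-remove x l x∈ = proj₂ (∈-filter⁻ (¬? ∘ (x ≟_)) {xs = l} x∈) ≡.refl

  ∈-remove⁻ : ∀ {x y} l → y ∈ remove x l → y ∈ l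
  ∈-remove⁻ {x} l y∈ = proj₁ (∈-filter⁻ (¬? ∘ (x ≟_)) {xs = l} y∈)

  ∈-remove⁺ : ∀ {x y} {l} → y ∈ l → x ≢ y → y ∈ remove x l
  ∈-remove⁺ {x} = ∈-filter⁺ (¬? ∘ (x ≟_))

  remove-unique : ∀ x {l} → Unique l → Unique (remove x l)
  remove-unique x = filter⁺ (¬? ∘ (x ≟_))

  length-remove : ∀ {x l} → Unique l → x ∈ l → suc (length (remove x l)) ≡ length l
  length-remove {l = y ∷ l} u (here ≡.refl) =
    ≡.cong (suc ∘ length) (≡.trans (remove-≡ l ≡.refl) (remove-∉ l (Unique[x∷xs]⇒x∉xs u)))
  length-remove {x} {y ∷ l} (y≢ ∷ u) (there x∈l) =
    ≡.trans (≡.cong (suc ∘ length) (remove-≢ l x≢y)) (≡.cong suc (length-remove u x∈l))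
    where
    x≢y : x ≢ y
    x≢y x≡y = All.lookup y≢ x∈l (≡.sym x≡y)

  deduplicate-unique : ∀ {l} → Unique l → deduplicate _≟_ l ≡ l
  deduplicate-unique []               = ≡.refl
  deduplicate-unique {x ∷ l} (x∉ ∷ u) =
    ≡.cong (x ∷_) (≡.trans (≡.cong (remove x) (deduplicate-unique u)) (filter-all (¬? ∘ (x ≟_)) x∉))

module Permutations {a} {A : Set a} where
  open import Data.List.Relation.Binary.Permutation.Setoid.Properties (≡.setoid A) using (Unique-resp-↭)

  ∈-insertions⇒↭ : ∀ {t} (y : A) l → t ∈ insertions y l → t ↭ y ∷ l
  ∈-insertions⇒↭ y []      (here ≡.refl) = ↭-refl
  ∈-insertions⇒↭ y (z ∷ l) (here ≡.refl) = ↭-refl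
  ∈-insertions⇒↭ y (z ∷ l) (there t∈)    with ∈-map⁻ (z ∷_) t∈
  ... | t , t∈′ , ≡.refl = ↭-trans (↭-prep z (∈-insertions⇒↭ y l t∈′)) (↭-swap z y ↭-refl)

  ∈-perms⇒↭ : ∀ {t} (l : List A) → t ∈ perms l → t ↭ l
  ∈-perms⇒↭ []      (here ≡.refl) = ↭-refl
  ∈-perms⇒↭ (y ∷ l) t∈ with find (∈-concatMap⁻ (insertions y) {xs = perms l} t∈)
  ... | s , s∈ , t∈′ = ↭-trans (∈-insertions⇒↭ y s t∈′) (↭-prep y (∈-perms⇒↭ l s∈))

  ∈-perms-∈ : ∀ {t l} {z : A} → t ∈ perms l → z ∈ t → z ∈ l
  ∈-perms-∈ {l = l} t∈ = ∈-resp-↭ (∈-perms⇒↭ l t∈)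

  perms-unique : ∀ {t l : List A} → Unique l → t ∈ perms l → Unique t
  perms-unique {l = l} u t∈ = Unique-resp-↭ (↭⇒↭ₛ (↭-sym (∈-perms⇒↭ l t∈))) u

module PermutationSums {c ℓ a} (M : CommutativeMonoid c ℓ) {A : Set a} (_≟_ : DecidableEquality A) where
  open CommutativeMonoid M
    renaming (Carrier to C; _∙_ to _+_; ∙-cong to +-cong; ∙-congˡ to +-congˡ; ∙-congʳ to +-congʳ)
  open import Algebra.Properties.CommutativeSemigroup commutativeSemigroup using (x∙yz≈y∙xz)
  open import Algebra.Properties.Monoid.Mult monoid using (×-congʳ) renaming (_×_ to _·ℕ_)
  open import Relation.Binary.Reasoning.Setoid setoid
  open ListSum M
  open Removal _≟_
  open Permutations

  ∑-remove : ∀ {x l} (f : A → C) → Unique l → x ∈ l → ∑ f l ≈ f x + ∑ f (remove x l)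
  ∑-remove {l = y ∷ l} f u (here ≡.refl) =
    +-congˡ (reflexive (≡.cong (∑ f) (≡.sym (≡.trans (remove-≡ l ≡.refl) (remove-∉ l (Unique[x∷xs]⇒x∉xs u))))))
  ∑-remove {x} {y ∷ l} f (y≢ ∷ u) (there x∈l) = begin
    f y + ∑ f l
      ≈⟨ +-congˡ (∑-remove f u x∈l) ⟩
    f y + (f x + ∑ f (remove x l))
      ≈⟨ x∙yz≈y∙xz _ _ _ ⟩
    f x + (f y + ∑ f (remove x l))
      ≡⟨ ≡.cong (λ r → f x + ∑ f r) (remove-≢ l (λ x≡y → All.lookup y≢ x∈l (≡.sym x≡y))) ⟨
    f x + ∑ f (remove x (y ∷ l)) ∎

  byFirst : (List A → C) → List A → C
  byFirst h l = ∑ (λ z → ∑ (h ∘ (z ∷_)) (perms (remove z l))) l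

  laterInsertions : A → List A → List (List A)
  laterInsertions y []      = []
  laterInsertions y (z ∷ t) = map (z ∷_) (insertions y t)

  ∑-insertions : ∀ (h : List A → C) y t → ∑ h (insertions y t) ≈ h (y ∷ t) + ∑ h (laterInsertions y t)
  ∑-insertions h y []      = refl
  ∑-insertions h y (z ∷ t) = refl

  ∑-perms-byFirst : ∀ y l → Unique (y ∷ l) → ∀ h → ∑ h (perms (y ∷ l)) ≈ byFirst h (y ∷ l)
  ∑-perms-byFirst y [] _ h = begin
    h (y ∷ []) + ε
      ≈⟨ identityʳ _ ⟨
    (h (y ∷ []) + ε) + ε
      ≡⟨ ≡.cong (λ r → ∑ (h ∘ (y ∷_)) (perms r) + ε) (remove-≡ [] ≡.refl) ⟨
    ∑ (h ∘ (y ∷_)) (perms (remove y (y ∷ []))) + ε ∎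
  ∑-perms-byFirst y (y′ ∷ l) u@(y≢ ∷ u′) h = begin
    ∑ h (perms (y ∷ y′ ∷ l))
      ≈⟨ ∑-concatMap h (insertions y) P ⟩
    ∑ (∑ h ∘ insertions y) P
      ≈⟨ ∑-cong P (∑-insertions h y) ⟩
    ∑ (λ t → h (y ∷ t) + later t) P
      ≈⟨ ∑-distrib-+ _ later P ⟩
    ∑ (h ∘ (y ∷_)) P + ∑ later P
      ≈⟨ +-cong (reflexive (≡.cong (∑ (h ∘ (y ∷_)) ∘ perms) removeHead)) (∑-perms-byFirst y′ l u′ later) ⟩
    ∑ (h ∘ (y ∷_)) (perms (remove y (y ∷ y′ ∷ l))) + byFirst later (y′ ∷ l)
      ≈⟨ +-congˡ (∑-cong-∈ (y′ ∷ l) laterByFirst) ⟩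
    byFirst h (y ∷ y′ ∷ l) ∎
    where
    P : List (List A)
    P = perms (y′ ∷ l)
    later : List A → C
    later = ∑ h ∘ laterInsertions y
    removeHead : y′ ∷ l ≡ remove y (y ∷ y′ ∷ l)
    removeHead = ≡.sym (≡.trans (remove-≡ _ ≡.refl) (remove-∉ _ (Unique[x∷xs]⇒x∉xs u)))
    laterByFirst : ∀ {z} → z ∈ y′ ∷ l →
                   ∑ (later ∘ (z ∷_)) (perms (remove z (y′ ∷ l))) ≈ ∑ (h ∘ (z ∷_)) (perms (remove z (y ∷ y′ ∷ l)))
    laterByFirst {z} z∈ = begin
      ∑ (later ∘ (z ∷_)) (perms (remove z (y′ ∷ l)))
        ≈⟨ ∑-cong (perms (remove z (y′ ∷ l))) (λ t → ∑-map h (z ∷_) (insertions y t)) ⟩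
      ∑ (∑ (h ∘ (z ∷_)) ∘ insertions y) (perms (remove z (y′ ∷ l)))
        ≈⟨ ∑-concatMap (h ∘ (z ∷_)) (insertions y) (perms (remove z (y′ ∷ l))) ⟨
      ∑ (h ∘ (z ∷_)) (perms (y ∷ remove z (y′ ∷ l)))
        ≡⟨ ≡.cong (∑ (h ∘ (z ∷_)) ∘ perms) (remove-≢ _ (λ z≡y → All.lookup y≢ z∈ (≡.sym z≡y))) ⟨
      ∑ (h ∘ (z ∷_)) (perms (remove z (y ∷ y′ ∷ l))) ∎

  -- ∑-perms-byFirst fails for the empty list, where the factor m = 0 rescues it.
  ·ℕ-byFirst : ∀ m {l} → length l ≡ m → Unique l → ∀ h → m ·ℕ byFirst h l ≈ m ·ℕ ∑ h (perms l)
  ·ℕ-byFirst zero    _      _ h = refl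
  ·ℕ-byFirst (suc m) {y ∷ l} _ u h = ×-congʳ (suc m) (sym (∑-perms-byFirst y l u h))

  ∑-perms-remove : ∀ m {x l} → length l ≡ m → Unique l → x ∈ l → ∀ (k : List A → C) →
                   ∑ (k ∘ remove x) (perms l) ≈ m ·ℕ ∑ k (perms (remove x l))
  ∑-perms-remove (suc m) {x} {l@(y ∷ l′)} |l|≡1+m u x∈l k = begin
    ∑ (k ∘ remove x) (perms l) ≈⟨ ∑-perms-byFirst y l′ u (k ∘ remove x) ⟩
    byFirst (k ∘ remove x) l   ≈⟨ ∑-remove f u x∈l ⟩
    f x + ∑ f (remove x l)     ≈⟨ +-cong startingWithX startingWithOthers ⟩
    S + m ·ℕ S                 ∎
    where
    S : C
    S = ∑ k (perms (remove x l))
    f : A → C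
    f z = ∑ (λ t → k (remove x (z ∷ t))) (perms (remove z l))
    length-remove′ : ∀ {z} → z ∈ l → length (remove z l) ≡ m
    length-remove′ z∈l = suc-injective (≡.trans (length-remove u z∈l) |l|≡1+m)
    startingWithX : f x ≈ S
    startingWithX = ∑-cong-∈ (perms (remove x l)) λ t∈ →
      reflexive (≡.cong k (≡.trans (remove-≡ _ ≡.refl) (remove-∉ _ (∉-remove x l ∘ ∈-perms-∈ t∈))))
    startingWith : ∀ {z} → z ∈ remove x l → f z ≈ m ·ℕ ∑ (k ∘ (z ∷_)) (perms (remove z (remove x l)))
    startingWith {z} z∈ = begin
      f z
        ≈⟨ ∑-cong (perms (remove z l)) (λ t → reflexive (≡.cong k (remove-≢ t x≢z))) ⟩
      ∑ (k ∘ (z ∷_) ∘ remove x) (perms (remove z l))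
        ≈⟨ ∑-perms-remove m (length-remove′ z∈l) (remove-unique z u) (∈-remove⁺ x∈l (x≢z ∘ ≡.sym)) (k ∘ (z ∷_)) ⟩
      m ·ℕ ∑ (k ∘ (z ∷_)) (perms (remove x (remove z l)))
        ≡⟨ ≡.cong (λ r → m ·ℕ ∑ (k ∘ (z ∷_)) (perms r)) (remove-comm x z l) ⟩
      m ·ℕ ∑ (k ∘ (z ∷_)) (perms (remove z (remove x l))) ∎
      where
      z∈l : z ∈ l
      z∈l = ∈-remove⁻ l z∈
      x≢z : x ≢ z
      x≢z x≡z = ∉-remove x l (≡.subst (_∈ remove x l) (≡.sym x≡z) z∈)
    startingWithOthers : ∑ f (remove x l) ≈ m ·ℕ S
    startingWithOthers = begin
      ∑ f (remove x l)
        ≈⟨ ∑-cong-∈ (remove x l) startingWith ⟩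
      ∑ (λ z → m ·ℕ ∑ (k ∘ (z ∷_)) (perms (remove z (remove x l)))) (remove x l)
        ≈⟨ ∑-distrib-·ℕ m _ (remove x l) ⟩
      m ·ℕ byFirst k (remove x l)
        ≈⟨ ·ℕ-byFirst m (length-remove′ x∈l) (remove-unique x u) k ⟩
      m ·ℕ S ∎

  ∑-∑-perms-moveToFront : ∀ {l} → Unique l → ∀ (h : List A → C) →
                          ∑ (λ x → ∑ (h ∘ moveToFront x) (perms l)) l ≈ length l ·ℕ ∑ h (perms l)
  ∑-∑-perms-moveToFront {[]}    _ h = refl
  ∑-∑-perms-moveToFront {y ∷ l} u h = begin
    ∑ (λ x → ∑ (h ∘ moveToFront x) (perms (y ∷ l))) (y ∷ l)
      ≈⟨ ∑-cong-∈ (y ∷ l) (λ x∈ → ∑-perms-remove m ≡.refl u x∈ _) ⟩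
    ∑ (λ x → m ·ℕ ∑ (h ∘ (x ∷_)) (perms (remove x (y ∷ l)))) (y ∷ l)
      ≈⟨ ∑-distrib-·ℕ m _ (y ∷ l) ⟩
    m ·ℕ byFirst h (y ∷ l)
      ≈⟨ ×-congʳ m (∑-perms-byFirst y l u h) ⟨
    m ·ℕ ∑ h (perms (y ∷ l)) ∎
    where
    m : ℕ
    m = length (y ∷ l)

module Evaluation {c ℓ} (R : CommutativeRing c ℓ) (n : ℕ) where
  open CommutativeRing R renaming (Carrier to K)
  open import Algebra.Properties.Semiring.Mult semiring using (×-assoc-*; ×-congʳ) renaming (_×_ to _·ℕ_)
  open import Algebra.Properties.CommutativeSemigroup *-commutativeSemigroup using (x∙yz≈y∙xz)
  open import Relation.Binary.Reasoning.Setoid setoid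
  open FLRB R n
  open ListSum +-commutativeMonoid
  open PermutationSums +-commutativeMonoid (≡-dec (Fin._≟_ {n})) using (∑-remove)
  open Removal (≡-dec (Fin._≟_ {n})) using (remove; ∉-remove)

  eval : (Word n → K) → Elt → K
  eval g = ∑ (λ (k , w) → k * g w)

  ∑-distribˡ-* : ∀ {a} {A : Set a} k (f : A → K) l → ∑ (λ x → k * f x) l ≈ k * ∑ f l
  ∑-distribˡ-* k f []      = sym (zeroʳ k)
  ∑-distribˡ-* k f (x ∷ l) = trans (+-congˡ (∑-distribˡ-* k f l)) (sym (distribˡ k _ _))

  ι-* : ∀ m x → ι m * x ≈ m ·ℕ x
  ι-* m x = trans (×-assoc-* m 1# x) (×-congʳ m (*-identityˡ x))

  eval-cong : ∀ {g g′} e → (∀ w → g w ≈ g′ w) → eval g e ≈ eval g′ e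
  eval-cong e g≈g′ = ∑-cong e (λ (k , w) → *-congˡ (g≈g′ w))

  eval-cong-All : ∀ {g g′} {e} → All (λ (k , w) → g w ≈ g′ w) e → eval g e ≈ eval g′ e
  eval-cong-All {e = e} g≈g′ = ∑-cong-∈ e (λ p∈ → *-congˡ (All.lookup g≈g′ p∈))

  eval-scaled : ∀ g k (φ : Word n → Word n) f → eval g (map (λ (d , w) → (k * d , φ w)) f) ≈ k * eval (g ∘ φ) f
  eval-scaled g k φ f = begin
    eval g (map (λ (d , w) → (k * d , φ w)) f) ≈⟨ ∑-map _ _ f ⟩
    ∑ (λ (d , w) → (k * d) * g (φ w)) f        ≈⟨ ∑-cong f (λ _ → *-assoc _ _ _) ⟩
    ∑ (λ (d , w) → k * (d * g (φ w))) f        ≈⟨ ∑-distribˡ-* k _ f ⟩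
    k * eval (g ∘ φ) f                         ∎

  eval-⊕ : ∀ g e f → eval g (e ⊕ f) ≈ eval g e + eval g f
  eval-⊕ g = ∑-++ _

  eval-⊙ : ∀ g m e → eval g (m ⊙ e) ≈ ι m * eval g e
  eval-⊙ g m = eval-scaled g (ι m) id

  eval-⊛ : ∀ g e f → eval g (e ⊛ f) ≈ eval (λ u → eval (λ w → g (u ·w w)) f) e
  eval-⊛ g []            f = refl
  eval-⊛ g ((k , u) ∷ e) f =
    trans (eval-⊕ g (map (λ (d , w) → (k * d , u ·w w)) f) (e ⊛ f))
          (+-cong (eval-scaled g k (u ·w_) f) (eval-⊛ g e f))

  eval-linExt : ∀ g F e → eval g (linExt F e) ≈ eval (λ u → eval g (F u)) e
  eval-linExt g F []            = refl
  eval-linExt g F ((k , u) ∷ e) =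
    trans (eval-⊕ g (map (λ (d , w) → (k * d , w)) (F u)) (linExt F e))
          (+-cong (eval-scaled g k id (F u)) (eval-linExt g F e))

  eval-[] : ∀ g w → eval g [ w ] ≈ g w
  eval-[] g w = trans (+-identityʳ _) (*-identityˡ _)

  eval-unitTerms : ∀ {a} {A : Set a} g (h : A → Word n) l → eval g (map (λ b → (1# , h b)) l) ≈ ∑ (g ∘ h) l
  eval-unitTerms g h l = trans (∑-map _ _ l) (∑-cong l (λ _ → *-identityˡ _))

  eval-+ : ∀ g g′ e → eval (λ w → g w + g′ w) e ≈ eval g e + eval g′ e
  eval-+ g g′ e = trans (∑-cong e (λ _ → distribˡ _ _ _)) (∑-distrib-+ _ _ e)

  eval-*ˡ : ∀ k g e → eval (λ w → k * g w) e ≈ k * eval g e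
  eval-*ˡ k g e = trans (∑-cong e (λ _ → x∙yz≈y∙xz _ _ _)) (∑-distribˡ-* k _ e)

  eval-comm : ∀ (h : Word n → Word n → K) e f →
              eval (λ u → eval (h u) f) e ≈ eval (λ w → eval (λ u → h u w) e) f
  eval-comm h e f = begin
    eval (λ u → eval (h u) f) e                         ≈⟨ ∑-cong e (λ (k , u) → eval-*ˡ k (h u) f) ⟨
    ∑ (λ (k , u) → eval (λ w → k * h u w) f) e          ≈⟨ ∑-comm _ e f ⟩
    ∑ (λ (d , w) → ∑ (λ (k , u) → d * (k * h u w)) e) f ≈⟨ ∑-cong f (λ (d , w) → ∑-distribˡ-* d _ e) ⟩
    eval (λ w → eval (λ u → h u w) e) f                 ∎

  indicator : Word n → Word n → K
  indicator w u with ≡-dec Fin._≟_ u w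
  ... | yes _ = 1#
  ... | no  _ = 0#

  coeff-∷ : ∀ w k u e → coeff w ((k , u) ∷ e) ≈ k * indicator w u + coeff w e
  coeff-∷ w k u e with ≡-dec Fin._≟_ u w
  ... | yes _ = +-congʳ (sym (*-identityʳ k))
  ... | no  _ = sym (trans (+-congʳ (zeroʳ k)) (+-identityˡ _))

  ∑-indicator : ∀ {W u} (f : Word n → K) → Unique W → u ∈ W → ∑ (λ w → indicator w u * f w) W ≈ f u
  ∑-indicator {W} {u} f uW u∈W = begin
    ∑ (λ w → indicator w u * f w) W
      ≈⟨ ∑-remove _ uW u∈W ⟩
    indicator u u * f u + ∑ (λ w → indicator w u * f w) (remove u W)
      ≈⟨ +-cong (*-congʳ ind-u) (∑-cong-∈ (remove u W) ind-other) ⟩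
    1# * f u + ∑ (λ _ → 0#) (remove u W)
      ≈⟨ +-cong (*-identityˡ _) (∑-ε (remove u W)) ⟩
    f u + 0#
      ≈⟨ +-identityʳ _ ⟩
    f u ∎
    where
    ind-u : indicator u u ≈ 1#
    ind-u with ≡-dec Fin._≟_ u u
    ... | yes _   = refl
    ... | no  u≢u = ⊥-elim (u≢u ≡.refl)
    ind-other : ∀ {w} → w ∈ remove u W → indicator w u * f w ≈ 0#
    ind-other {w} w∈ with ≡-dec Fin._≟_ u w
    ... | yes ≡.refl = ⊥-elim (∉-remove u W w∈)
    ... | no  _      = zeroˡ _

  eval-expansion : ∀ {W} g e → Unique W → All (λ (k , w) → w ∈ W) e → eval g e ≈ ∑ (λ w → coeff w e * g w) W
  eval-expansion {W} g [] uW _ = sym (trans (∑-cong W (λ _ → zeroˡ _)) (∑-ε W))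
  eval-expansion {W} g ((k , u) ∷ e) uW (u∈W ∷ e⊆W) = begin
    k * g u + eval g e
      ≈⟨ +-cong (*-congˡ (∑-indicator g uW u∈W)) (sym (eval-expansion g e uW e⊆W)) ⟨
    k * ∑ (λ w → indicator w u * g w) W + ∑ (λ w → coeff w e * g w) W
      ≈⟨ +-congʳ (∑-distribˡ-* k _ W) ⟨
    ∑ (λ w → k * (indicator w u * g w)) W + ∑ (λ w → coeff w e * g w) W
      ≈⟨ ∑-distrib-+ _ _ W ⟨
    ∑ (λ w → k * (indicator w u * g w) + coeff w e * g w) W
      ≈⟨ ∑-cong W coeff-∷-term ⟨
    ∑ (λ w → coeff w ((k , u) ∷ e) * g w) W ∎
    where
    coeff-∷-term : ∀ w → coeff w ((k , u) ∷ e) * g w ≈ k * (indicator w u * g w) + coeff w e * g w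
    coeff-∷-term w = trans (*-congʳ (coeff-∷ w k u e)) (trans (distribʳ _ _ _) (+-congʳ (*-assoc _ _ _)))

  infix 4 _≈ₑ_
  record _≈ₑ_ (e f : Elt) : Set (c ⊔ ℓ) where
    field eval-≈ : ∀ g → eval g e ≈ eval g f
  open _≈ₑ_ public

  ≈ₑ⇒≋ : ∀ {e f} → e ≈ₑ f → e ≋ f
  ≈ₑ⇒≋ {e} {f} e≈f w = begin
    coeff w e            ≈⟨ coeffs e ⟩
    eval (indicator w) e ≈⟨ e≈f .eval-≈ (indicator w) ⟩
    eval (indicator w) f ≈⟨ coeffs f ⟨
    coeff w f            ∎
    where
    coeffs : ∀ e → coeff w e ≈ eval (indicator w) e
    coeffs []            = refl
    coeffs ((k , u) ∷ e) = trans (coeff-∷ w k u e) (+-congˡ (coeffs e))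

  ≋⇒≈ₑ : ∀ {e f} → e ≋ f → e ≈ₑ f
  ≋⇒≈ₑ {e} {f} e≋f .eval-≈ g = begin
    eval g e                    ≈⟨ eval-expansion g e uW (All.tabulate (λ p∈ → inW (∈-++⁺ˡ p∈))) ⟩
    ∑ (λ w → coeff w e * g w) W ≈⟨ ∑-cong W (λ w → *-congʳ (e≋f w)) ⟩
    ∑ (λ w → coeff w f * g w) W ≈⟨ eval-expansion g f uW (All.tabulate (λ p∈ → inW (∈-++⁺ʳ e p∈))) ⟨
    eval g f                    ∎
    where
    W : List (Word n)
    W = deduplicate (≡-dec Fin._≟_) (map proj₂ (e ++ f))
    uW : Unique W
    uW = deduplicate-! (≡-dec Fin._≟_) (map proj₂ (e ++ f))
    inW : ∀ {p} → p ∈ e ++ f → proj₂ p ∈ W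
    inW p∈ = ∈-deduplicate⁺ (≡-dec Fin._≟_) (∈-map⁺ proj₂ p∈)

  record IsLinear (T : Elt → Elt) : Set (c ⊔ ℓ) where
    field eval-linear : ∀ g e → eval g (T e) ≈ eval (λ w → eval g (T [ w ])) e
  open IsLinear

  linExt-linear : ∀ F → IsLinear (linExt F)
  linExt-linear F .eval-linear g e =
    trans (eval-linExt g F e) (eval-cong e λ w → sym (trans (eval-linExt g F [ w ]) (eval-[] (λ v → eval g (F v)) w)))

  ⊛-linear : ∀ e → IsLinear (e ⊛_)
  ⊛-linear e .eval-linear g f = begin
    eval g (e ⊛ f)
      ≈⟨ eval-⊛ g e f ⟩
    eval (λ u → eval (λ w → g (u ·w w)) f) e
      ≈⟨ eval-comm _ e f ⟩
    eval (λ w → eval (λ u → g (u ·w w)) e) f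
      ≈⟨ eval-cong f (λ w → trans (eval-⊛ g e [ w ]) (eval-cong e (λ u → eval-[] (λ v → g (u ·w v)) w))) ⟨
    eval (λ w → eval g (e ⊛ [ w ])) f ∎

  ⊙-linear : ∀ m → IsLinear (m ⊙_)
  ⊙-linear m .eval-linear g e = begin
    eval g (m ⊙ e)                    ≈⟨ eval-⊙ g m e ⟩
    ι m * eval g e                    ≈⟨ eval-*ˡ (ι m) g e ⟨
    eval (λ w → ι m * g w) e          ≈⟨ eval-cong e (λ w → trans (eval-⊙ g m [ w ]) (*-congˡ (eval-[] g w))) ⟨
    eval (λ w → eval g (m ⊙ [ w ])) e ∎

  ∘-linear : ∀ {S T} → IsLinear S → IsLinear T → IsLinear (S ∘ T)
  ∘-linear {S} {T} S-lin T-lin .eval-linear g e = begin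
    eval g (S (T e))
      ≈⟨ S-lin .eval-linear g (T e) ⟩
    eval (λ u → eval g (S [ u ])) (T e)
      ≈⟨ T-lin .eval-linear _ e ⟩
    eval (λ w → eval (λ u → eval g (S [ u ])) (T [ w ])) e
      ≈⟨ eval-cong e (λ w → S-lin .eval-linear g (T [ w ])) ⟨
    eval (λ w → eval g (S (T [ w ]))) e ∎

  ⊕-linear : ∀ {S T} → IsLinear S → IsLinear T → IsLinear (λ e → S e ⊕ T e)
  ⊕-linear {S} {T} S-lin T-lin .eval-linear g e = begin
    eval g (S e ⊕ T e)
      ≈⟨ eval-⊕ g (S e) (T e) ⟩
    eval g (S e) + eval g (T e)
      ≈⟨ +-cong (S-lin .eval-linear g e) (T-lin .eval-linear g e) ⟩
    eval (λ w → eval g (S [ w ])) e + eval (λ w → eval g (T [ w ])) e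
      ≈⟨ eval-+ _ _ e ⟨
    eval (λ w → eval g (S [ w ]) + eval g (T [ w ])) e
      ≈⟨ eval-cong e (λ w → eval-⊕ g (S [ w ]) (T [ w ])) ⟨
    eval (λ w → eval g (S [ w ] ⊕ T [ w ])) e ∎

  linear-resp-≈ₑ : ∀ {T e f} → IsLinear T → e ≈ₑ f → T e ≈ₑ T f
  linear-resp-≈ₑ {e = e} {f} T-lin e≈f .eval-≈ g =
    trans (T-lin .eval-linear g e) (trans (e≈f .eval-≈ _) (sym (T-lin .eval-linear g f)))

  linear-≈ₑ-onWords : ∀ {S T} → IsLinear S → IsLinear T →
                      ∀ {e} → All (λ (k , w) → S [ w ] ≈ₑ T [ w ]) e → S e ≈ₑ T e
  linear-≈ₑ-onWords S-lin T-lin {e} S≈T .eval-≈ g =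
    trans (S-lin .eval-linear g e)
          (trans (eval-cong-All (All.map (λ S≈T[w] → S≈T[w] .eval-≈ g) S≈T)) (sym (T-lin .eval-linear g e)))

length-members-∷ : ∀ {n} s (U : Subset n) → length (filter (_∈? (s ∷ U)) (tabulate Fin.suc)) ≡ length (members U)
length-members-∷ {n} s U =
  ≡.trans (≡.cong (length ∘ filter (_∈? (s ∷ U))) (≡.sym (map-tabulate id Fin.suc))) (shift (allFin n))
  where
  shift : ∀ l → length (filter (_∈? (s ∷ U)) (map Fin.suc l)) ≡ length (filter (_∈? U) l)
  shift []      = ≡.refl
  shift (i ∷ l) with i ∈? U
  ... | yes _ = ≡.cong suc (shift l)
  ... | no  _ = shift l

length-members : ∀ {n} (U : Subset n) → length (members U) ≡ ∣ U ∣
length-members []            = ≡.refl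
length-members (inside  ∷ U) = ≡.cong suc (≡.trans (length-members-∷ inside U) (length-members U))
length-members (outside ∷ U) = ≡.trans (length-members-∷ outside U) (length-members U)

module Complement {n} (U : Subset n) where
  open Removal (Fin._≟_ {n})
  open Permutations

  members-unique : Unique (members U)
  members-unique = filter⁺ (_∈? U) (allFin⁺ n)

  ∈-members⁻ : ∀ {i} → i ∈ members U → i ∈ₛ U
  ∈-members⁻ i∈ = proj₂ (∈-filter⁻ (_∈? U) {xs = allFin n} i∈)

  ∈-nonmembers⁻ : ∀ {i} → i ∈ nonmembers U → i ∉ₛ U
  ∈-nonmembers⁻ i∈ = proj₂ (∈-filter⁻ (¬? ∘ (_∈? U)) {xs = allFin n} i∈)

  singleton-·w : ∀ i {w : Word n} → Unique w → (i ∷ []) ·w w ≡ moveToFront i w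
  singleton-·w i u = ≡.cong (moveToFront i) (deduplicate-unique u)

  module _ {a : Word n} (a-perm : IsPermOfCompl U a) where

    ∉-complement : ∀ {i} → i ∈ a → i ∉ₛ U
    ∉-complement i∈a = Equivalence.to (proj₂ a-perm _) i∈a

    ++-unique : ∀ {b} → b ∈ perms (members U) → Unique (b ++ a)
    ++-unique b∈ = ++⁺ (perms-unique members-unique b∈) (proj₁ a-perm)
                       (λ (i∈b , i∈a) → ∉-complement i∈a (∈-members⁻ (∈-perms-∈ b∈ i∈b)))

module ComplementSums {c ℓ} (M : CommutativeMonoid c ℓ) {n} (U : Subset n) where
  open CommutativeMonoid M
    renaming (Carrier to C; _∙_ to _+_; ∙-cong to +-cong; ∙-congˡ to +-congˡ; ∙-congʳ to +-congʳ)
  open import Algebra.Definitions.RawMonoid rawMonoid renaming (_×_ to _·ℕ_)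
  open import Relation.Binary.Reasoning.Setoid setoid
  open ListSum M
  open PermutationSums M (Fin._≟_ {n})
  open Removal (Fin._≟_ {n})
  open Permutations
  open Complement U

  ∑-x⊛Ψ : ∀ {a} → IsPermOfCompl U a → ∀ (g : Word n → C) →
          ∑ (λ i → ∑ (λ b → g ((i ∷ []) ·w (b ++ a))) (perms (members U))) (allFin n)
          ≈ ∣ U ∣ ·ℕ ∑ (λ b → g (b ++ a)) (perms (members U))
            + ∑ (λ i → ∑ (λ b → g (i ∷ b ++ remove i a)) (perms (members U))) (nonmembers U)
  ∑-x⊛Ψ {a} a-perm g = begin
    ∑ F (allFin n)
      ≈⟨ ∑-partition (_∈? U) F (allFin n) ⟩
    ∑ F (members U) + ∑ F (nonmembers U)
      ≈⟨ +-cong (∑-cong-∈ (members U) member) (∑-cong-∈ (nonmembers U) nonmember) ⟩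
    ∑ (λ i → ∑ (h ∘ moveToFront i) P) (members U) + ∑ Φa (nonmembers U)
      ≈⟨ +-congʳ (∑-∑-perms-moveToFront members-unique h) ⟩
    length (members U) ·ℕ ∑ h P + ∑ Φa (nonmembers U)
      ≡⟨ ≡.cong (λ m → m ·ℕ ∑ h P + ∑ Φa (nonmembers U)) (length-members U) ⟩
    ∣ U ∣ ·ℕ ∑ h P + ∑ Φa (nonmembers U) ∎
    where
    P : List (Word n)
    P = perms (members U)
    h : Word n → C
    h b = g (b ++ a)
    F Φa : Fin.Fin n → C
    F i = ∑ (λ b → g ((i ∷ []) ·w (b ++ a))) P
    Φa i = ∑ (λ b → g (i ∷ b ++ remove i a)) P
    ·w-++ : ∀ i {b} → b ∈ P → (i ∷ []) ·w (b ++ a) ≡ i ∷ remove i b ++ remove i a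
    ·w-++ i {b} b∈ = ≡.trans (singleton-·w i (++-unique a-perm b∈)) (≡.cong (i ∷_) (remove-++ i b a))
    member : ∀ {i} → i ∈ members U → F i ≈ ∑ (h ∘ moveToFront i) P
    member {i} i∈ = ∑-cong-∈ P λ b∈ → reflexive (≡.cong g (≡.trans (·w-++ i b∈)
      (≡.cong (λ r → i ∷ _ ++ r) (remove-∉ a (λ i∈a → ∉-complement a-perm i∈a (∈-members⁻ i∈))))))
    nonmember : ∀ {i} → i ∈ nonmembers U → F i ≈ Φa i
    nonmember {i} i∈ = ∑-cong-∈ P λ {b} b∈ → reflexive (≡.cong g (≡.trans (·w-++ i b∈)
      (≡.cong (λ r → i ∷ r ++ remove i a) (remove-∉ b (λ i∈b → ∈-nonmembers⁻ i∈ (∈-members⁻ (∈-perms-∈ b∈ i∈b)))))))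

module LeftMultiplicationByX {c ℓ} (R : CommutativeRing c ℓ) (n : ℕ) (U : Subset n) where
  open CommutativeRing R renaming (Carrier to K)
  open import Relation.Binary.Reasoning.Setoid setoid
  open FLRB R n
  open Evaluation R n
  open ListSum +-commutativeMonoid
  open import Algebra.Properties.Semiring.Mult semiring using (×-congʳ) renaming (_×_ to _·ℕ_)
  open ComplementSums +-commutativeMonoid U
  open Removal (Fin._≟_ {n}) using (remove)
  open Complement U

  P : List (Word n)
  P = perms (members U)

  eval-Ψ-[] : ∀ g a → eval g (Ψ U [ a ]) ≈ ∑ (λ b → g (b ++ a)) P
  eval-Ψ-[] g a =
    trans (eval-linExt g (Ψw U) [ a ]) (trans (eval-[] (λ w → eval g (Ψw U w)) a) (eval-unitTerms g (_++ a) P))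

  eval-Φ-xᶜ⊛ : ∀ {a} → IsPermOfCompl U a → ∀ g →
               eval g (Φ U (xOf (nonmembers U) ⊛ [ a ])) ≈ ∑ (λ i → ∑ (λ b → g (i ∷ b ++ remove i a)) P) (nonmembers U)
  eval-Φ-xᶜ⊛ {a} a-perm g = begin
    eval g (Φ U (xOf (nonmembers U) ⊛ [ a ]))
      ≈⟨ eval-linExt g (Φw U) (xOf (nonmembers U) ⊛ [ a ]) ⟩
    eval (λ u → eval g (Φw U u)) (xOf (nonmembers U) ⊛ [ a ])
      ≈⟨ eval-⊛ _ (xOf (nonmembers U)) [ a ] ⟩
    eval (λ u → eval (λ w → eval g (Φw U (u ·w w))) [ a ]) (xOf (nonmembers U))
      ≈⟨ eval-unitTerms _ (_∷ []) (nonmembers U) ⟩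
    ∑ (λ i → eval (λ w → eval g (Φw U ((i ∷ []) ·w w))) [ a ]) (nonmembers U)
      ≈⟨ ∑-cong (nonmembers U) Φ-term ⟩
    ∑ (λ i → ∑ (λ b → g (i ∷ b ++ remove i a)) P) (nonmembers U) ∎
    where
    Φ-term : ∀ i → eval (λ w → eval g (Φw U ((i ∷ []) ·w w))) [ a ] ≈ ∑ (λ b → g (i ∷ b ++ remove i a)) P
    Φ-term i = begin
      eval (λ w → eval g (Φw U ((i ∷ []) ·w w))) [ a ]
        ≈⟨ eval-[] (λ w → eval g (Φw U ((i ∷ []) ·w w))) a ⟩
      eval g (Φw U ((i ∷ []) ·w a))
        ≡⟨ ≡.cong (eval g ∘ Φw U) (singleton-·w i (proj₁ a-perm)) ⟩
      eval g (Φw U (i ∷ remove i a))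
        ≈⟨ eval-unitTerms g (λ b → i ∷ b ++ remove i a) P ⟩
      ∑ (λ b → g (i ∷ b ++ remove i a)) P ∎

  x⊛Ψ-word : ∀ {a} → IsPermOfCompl U a →
             x ⊛ Ψ U [ a ] ≈ₑ (∣ U ∣ ⊙ Ψ U [ a ]) ⊕ Φ U (xOf (nonmembers U) ⊛ [ a ])
  x⊛Ψ-word {a} a-perm .eval-≈ g = begin
    eval g (x ⊛ Ψ U [ a ])
      ≈⟨ eval-⊛ g x (Ψ U [ a ]) ⟩
    eval (λ u → eval (λ w → g (u ·w w)) (Ψ U [ a ])) x
      ≈⟨ eval-unitTerms _ (_∷ []) (allFin n) ⟩
    ∑ (λ i → eval (λ w → g ((i ∷ []) ·w w)) (Ψ U [ a ])) (allFin n)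
      ≈⟨ ∑-cong (allFin n) (λ i → eval-Ψ-[] _ a) ⟩
    ∑ (λ i → ∑ (λ b → g ((i ∷ []) ·w (b ++ a))) P) (allFin n)
      ≈⟨ ∑-x⊛Ψ a-perm g ⟩
    ∣ U ∣ ·ℕ ∑ (λ b → g (b ++ a)) P + ∑ (λ i → ∑ (λ b → g (i ∷ b ++ remove i a)) P) (nonmembers U)
      ≈⟨ +-cong (trans (ι-* ∣ U ∣ _) (×-congʳ ∣ U ∣ (eval-Ψ-[] g a))) (eval-Φ-xᶜ⊛ a-perm g) ⟨
    ι ∣ U ∣ * eval g (Ψ U [ a ]) + eval g (Φ U (xOf (nonmembers U) ⊛ [ a ]))
      ≈⟨ trans (eval-⊕ g (∣ U ∣ ⊙ Ψ U [ a ]) _) (+-congʳ (eval-⊙ g ∣ U ∣ (Ψ U [ a ]))) ⟨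
    eval g ((∣ U ∣ ⊙ Ψ U [ a ]) ⊕ Φ U (xOf (nonmembers U) ⊛ [ a ])) ∎

  x⊛Ψ-eigenvector : ∀ {v} → All (λ (k , a) → IsPermOfCompl U a) v → (xOf (nonmembers U) ⊛ v) ≋ zeroE →
                    x ⊛ Ψ U v ≈ₑ ∣ U ∣ ⊙ Ψ U v
  x⊛Ψ-eigenvector {v} v-perm xᶜ⊛v≋0 .eval-≈ g = begin
    eval g (x ⊛ Ψ U v)
      ≈⟨ linear-≈ₑ-onWords lhs-linear rhs-linear (All.map x⊛Ψ-word v-perm) .eval-≈ g ⟩
    eval g ((∣ U ∣ ⊙ Ψ U v) ⊕ Φ U (xOf (nonmembers U) ⊛ v))
      ≈⟨ eval-⊕ g (∣ U ∣ ⊙ Ψ U v) _ ⟩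
    eval g (∣ U ∣ ⊙ Ψ U v) + eval g (Φ U (xOf (nonmembers U) ⊛ v))
      ≈⟨ +-congˡ (Φ-vanishes .eval-≈ g) ⟩
    eval g (∣ U ∣ ⊙ Ψ U v) + 0#
      ≈⟨ +-identityʳ _ ⟩
    eval g (∣ U ∣ ⊙ Ψ U v) ∎
    where
    Φ-vanishes : Φ U (xOf (nonmembers U) ⊛ v) ≈ₑ zeroE
    Φ-vanishes = linear-resp-≈ₑ {e = xOf (nonmembers U) ⊛ v} {f = zeroE} (linExt-linear (Φw U)) (≋⇒≈ₑ xᶜ⊛v≋0)
    lhs-linear : IsLinear (λ e → x ⊛ Ψ U e)
    lhs-linear = ∘-linear (⊛-linear x) (linExt-linear (Ψw U))
    rhs-linear : IsLinear (λ e → (∣ U ∣ ⊙ Ψ U e) ⊕ Φ U (xOf (nonmembers U) ⊛ e))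
    rhs-linear = ⊕-linear (∘-linear (⊙-linear ∣ U ∣) (linExt-linear (Ψw U)))
                          (∘-linear (linExt-linear (Φw U)) (⊛-linear (xOf (nonmembers U))))

proposition4p5 : ∀ {c ℓ} (R : CommutativeRing c ℓ) → IsField R → (n : ℕ)
    → Σ (CommutativeRing.Carrier R) (λ y → CommutativeRing._≈_ R (CommutativeRing._*_ R (FLRB.ι R n (n !)) y) (CommutativeRing.1# R))
    → (U : Subset n)
    → (∀ (a : Word n) → IsPermOfCompl U a
         → FLRB._≋_ R n (FLRB._⊛_ R n (FLRB.x R n) (FLRB.Ψ R n U (FLRB.[_] R n a)))
                        (FLRB._⊕_ R n (FLRB._⊙_ R n ∣ U ∣ (FLRB.Ψ R n U (FLRB.[_] R n a)))
                                      (FLRB.Φ R n U (FLRB._⊛_ R n (FLRB.xOf R n (nonmembers U)) (FLRB.[_] R n a)))))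
    × (∀ (v : FLRB.Elt R n) → All (λ p → IsPermOfCompl U (proj₂ p)) v
         → FLRB._≋_ R n (FLRB._⊛_ R n (FLRB.xOf R n (nonmembers U)) v) (FLRB.zeroE R n)
         → FLRB._≋_ R n (FLRB._⊛_ R n (FLRB.x R n) (FLRB.Ψ R n U v)) (FLRB._⊙_ R n ∣ U ∣ (FLRB.Ψ R n U v)))
proposition4p5 R _ n _ U =
    (λ a a-perm → ≈ₑ⇒≋ (x⊛Ψ-word a-perm))
  , (λ v v-perm xᶜ⊛v≋0 → ≈ₑ⇒≋ (x⊛Ψ-eigenvector v-perm xᶜ⊛v≋0))
  where
  open Evaluation R n using (≈ₑ⇒≋)
  open LeftMultiplicationByX R n U
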